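{- Let $A$ be a finite-dimensional associative algebra with unity over a field, and let $n=p_1^{d_1}\cdots p_s^{d_s}\ge 2$ where $2=p_1<p_2<\dots<p_s$ are primes and $d_1,\dots,d_s\ge 0$ are integers. Suppose the DFT of order $n$ is defined over $A$. Then $$D_A(n)\le\Bigl[\tfrac{3}{2}d_1+2\sum_{\sigma=2}^s d_\sigma(p_\sigma-1)-1\Bigr]n+1,$$ and in particular $$D_A(n)\le 2\max_{1\le\sigma\le s}p_\sigma\cdot n\log_2 n.$$
   Context: The DFT of order $n$ is defined over $A$ if $A$ contains a principal $n$-th root of unity $\omega$, i.e. $\omega^n=1_A$ and $1-\omega^\nu$ is not a zero divisor in $A$ for $1\le\nu<n$; the DFT of order $n$ with respect to $\omega$ maps $(a_0,\dots,a_{n-1})\in A^n$ to $(\tilde a_0,\dots,\tilde a_{n-1})$ with $\tilde a_i=\sum_{\nu=0}^{n-1}\omega^{i\nu}a_\nu$. $D_A(n)$ denotes the minimal total number of operations over $A$ (additions/subtractions of elements of $A$ and multiplications of elements of $A$ by powers of $\omega$) used by an algebraic (straight-line) algorithm computing the DFT of order $n$ over $A$ on arbitrary input. -}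

module Defs where

open import Level using (Level; _⊔_)
open import Data.Nat using (ℕ; zero; suc)
import Data.Nat as N
open import Data.Fin using (Fin; zero; suc)
import Data.Fin
open import Data.Product using (Σ; ∃; _×_)
open import Relation.Nullary using (¬_)
open import Algebra.Bundles using (Ring; CommutativeRing)
open import Algebra.Morphism.Structures using (module RingMorphisms)

private variable c ℓ a ℓa : Level

sumℕ : ∀ {t} → (Fin t → ℕ) → ℕ
sumℕ {zero}  f = 0
sumℕ {suc t} f = f zero N.+ sumℕ (λ i → f (suc i))

prodℕ : ∀ {t} → (Fin t → ℕ) → ℕ
prodℕ {zero}  f = 1
prodℕ {suc t} f = f zero N.* prodℕ (λ i → f (suc i))

maxℕ : ∀ {t} → ℕ → (Fin t → ℕ) → ℕ
maxℕ {zero}  m f = m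
maxℕ {suc t} m f = f zero N.⊔ maxℕ m (λ i → f (suc i))

module _ (A : Ring a ℓa) where
  open Ring A hiding (zero)

  pow : Carrier → ℕ → Carrier
  pow x zero    = 1#
  pow x (suc k) = x * pow x k

  sumR : ∀ {t} → (Fin t → Carrier) → Carrier
  sumR {zero}  f = 0#
  sumR {suc t} f = f zero + sumR (λ i → f (suc i))

  NotZeroDivisor : Carrier → Set (a ⊔ ℓa)
  NotZeroDivisor x = ∀ y → ((x * y ≈ 0# → y ≈ 0#) × (y * x ≈ 0# → y ≈ 0#))

  IsPrincipalRoot : ℕ → Carrier → Set (a ⊔ ℓa)
  IsPrincipalRoot n ω =
    (pow ω n ≈ 1#) × (∀ ν → 1 N.≤ ν → ν N.< n → NotZeroDivisor (1# - pow ω ν))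

  DFT : (n : ℕ) → Carrier → (Fin n → Carrier) → (Fin n → Carrier)
  DFT n ω x i = sumR (λ ν → pow ω (Data.Fin.toℕ i N.* Data.Fin.toℕ ν) * x ν)

record IsField (K : CommutativeRing c ℓ) : Set (c ⊔ ℓ) where
  open CommutativeRing K
  field
    1≉0 : ¬ (1# ≈ 0#)
    inverse : ∀ x → ¬ (x ≈ 0#) → ∃ λ y → x * y ≈ 1#

-- A unital associative K-algebra structure on the ring A: a unital ring
-- homomorphism K → A with central image; finite-dimensional: A is spanned
-- over K by finitely many elements.
record FinDimAlgebra (K : CommutativeRing c ℓ) (A : Ring a ℓa) : Set (c ⊔ ℓ ⊔ a ⊔ ℓa) where
  private
    module K = CommutativeRing K
    module A = Ring A
  open RingMorphisms K.rawRing A.rawRing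
  field
    φ        : K.Carrier → A.Carrier
    φ-hom    : IsRingHomomorphism φ
    central  : ∀ k x → φ k A.* x A.≈ x A.* φ k
    dim      : ℕ
    basis    : Fin dim → A.Carrier
    spanning : ∀ x → ∃ λ (coef : Fin dim → K.Carrier) →
                 x A.≈ sumR A (λ i → φ (coef i) A.* basis i)

-- A program with k values available
-- (initially the n inputs) appends one new value per instruction; the new
-- value gets index zero and older values are shifted by suc.

data Instr (k : ℕ) : Set where
  add  : Fin k → Fin k → Instr k
  sub  : Fin k → Fin k → Instr k
  mulω : ℕ → Fin k → Instr k

data SLP (m : ℕ) : ℕ → Set where
  ret  : ∀ {k} → (Fin m → Fin k) → SLP m k
  step : ∀ {k} → Instr k → SLP m (suc k) → SLP m k

cost : ∀ {m k} → SLP m k → ℕ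
cost (ret _)    = 0
cost (step _ p) = suc (cost p)

module _ (A : Ring a ℓa) where
  open Ring A hiding (zero)

  extend : ∀ {k} → Carrier → (Fin k → Carrier) → (Fin (suc k) → Carrier)
  extend v env zero    = v
  extend v env (suc i) = env i

  execInstr : ∀ {k} → Carrier → Instr k → (Fin k → Carrier) → Carrier
  execInstr ω (add i j)  env = env i + env j
  execInstr ω (sub i j)  env = env i - env j
  execInstr ω (mulω e i) env = pow A ω e * env i

  run : ∀ {m k} → Carrier → SLP m k → (Fin k → Carrier) → (Fin m → Carrier)
  run ω (ret out)  env = λ o → env (out o)
  run ω (step ι p) env = run ω p (extend (execInstr ω ι env) env)

  ComputesDFT : (n : ℕ) → Carrier → SLP n n → Set (a ⊔ ℓa)
  ComputesDFT n ω p = ∀ (x : Fin n → Carrier) (i : Fin n) → run ω p x i ≈ DFT A n ω x i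

-- Mixed-radix Cooley–Tukey.  Index the input of a DFT of order n = r m as an r × m array,
-- ν = a m + b, and the output as i = i₁ + r i₂.  The DFT is then m DFTs of order r along the
-- columns (over a), the multiplication of entry (b, i₁) by the twiddle factor ω^{b i₁}, and
-- r DFTs of order m along the rows (over b); twiddles with b = 0 or i₁ = 0 are free.  A factor
-- 2 is a butterfly (2 operations), an odd factor p is done by the defining formula ((p − 1)²
-- multiplications, p (p − 1) additions).  With these costs the number c of operations for
-- order n satisfies 2 c + 2 n = W n + 2 exactly, where each factor 2 contributes 3 and each
-- odd p contributes 4 (p − 1) to W.  The n log n bound follows because every contribution is
-- at most 4 max p and there are at most log₂ n factors.
module Submission where

open import Defs
open import Data.Nat using (ℕ; zero; suc; _+_; _*_; _∸_; _^_; _≤_; _<_; z≤n; s≤s)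
import Data.Nat.Properties as ℕ
open import Data.Nat.Tactic.RingSolver using (solve-∀)
open import Data.Nat.Primality using (Prime)
open import Data.Fin using (Fin; zero; suc; toℕ; combine; remQuot; cast; _↑ˡ_; _↑ʳ_)
import Data.Fin
open import Data.Fin.Properties using (toℕ-combine; combine-remQuot; toℕ-cast)
open import Data.List using (List; []; _∷_; _++_; replicate)
open import Data.Product using (Σ; _×_; _,_; proj₁; proj₂)
open import Data.Unit using (⊤; tt)
open import Function using (_∘_; id)
open import Level using (_⊔_)
open import Relation.Binary.PropositionalEquality as ≡ using (_≡_)
open import Algebra.Bundles using (Ring; CommutativeRing)
import Algebra.Properties.Group as GroupProperties
import Algebra.Properties.Ring as RingProperties
import Algebra.Properties.Semiring.Sum as SemiringSum
import Relation.Binary.Reasoning.Setoid as SetoidReasoning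


sumℕ-cong : ∀ {t} {f g : Fin t → ℕ} → (∀ i → f i ≡ g i) → sumℕ f ≡ sumℕ g
sumℕ-cong {zero}  f≗g = ≡.refl
sumℕ-cong {suc t} f≗g = ≡.cong₂ _+_ (f≗g zero) (sumℕ-cong (f≗g ∘ suc))

sumℕ-const : ∀ t c → sumℕ {t} (λ _ → c) ≡ t * c
sumℕ-const zero    c = ≡.refl
sumℕ-const (suc t) c = ≡.cong (c +_) (sumℕ-const t c)

sumℕ-+ : ∀ {t} (f g : Fin t → ℕ) → sumℕ (λ i → f i + g i) ≡ sumℕ f + sumℕ g
sumℕ-+ {zero}  f g = ≡.refl
sumℕ-+ {suc t} f g = begin
  f zero + g zero + sumℕ (λ i → f (suc i) + g (suc i))
    ≡⟨ ≡.cong (f zero + g zero +_) (sumℕ-+ (f ∘ suc) (g ∘ suc)) ⟩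
  f zero + g zero + (sumℕ (f ∘ suc) + sumℕ (g ∘ suc))
    ≡⟨ interchange (f zero) (g zero) _ _ ⟩
  f zero + sumℕ (f ∘ suc) + (g zero + sumℕ (g ∘ suc)) ∎
  where
  open ≡.≡-Reasoning
  interchange : ∀ a b c d → a + b + (c + d) ≡ a + c + (b + d)
  interchange = solve-∀

sumℕ-*ˡ : ∀ {t} c (f : Fin t → ℕ) → sumℕ (λ i → c * f i) ≡ c * sumℕ f
sumℕ-*ˡ {zero}  c f = ≡.sym (ℕ.*-zeroʳ c)
sumℕ-*ˡ {suc t} c f = ≡.trans (≡.cong (c * f zero +_) (sumℕ-*ˡ c (f ∘ suc)))
                              (≡.sym (ℕ.*-distribˡ-+ c (f zero) _))

sumℕ-*ʳ : ∀ {t} (f : Fin t → ℕ) c → sumℕ (λ i → f i * c) ≡ sumℕ f * c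
sumℕ-*ʳ f c = begin
  sumℕ (λ i → f i * c) ≡⟨ sumℕ-cong (λ i → ℕ.*-comm (f i) c) ⟩
  sumℕ (λ i → c * f i) ≡⟨ sumℕ-*ˡ c f ⟩
  c * sumℕ f           ≡⟨ ℕ.*-comm c (sumℕ f) ⟩
  sumℕ f * c           ∎
  where open ≡.≡-Reasoning

sumℕ-product : ∀ {m r} (f : Fin m → ℕ) (g : Fin r → ℕ) →
               sumℕ (λ i → sumℕ (λ j → f i * g j)) ≡ sumℕ f * sumℕ g
sumℕ-product f g = ≡.trans (sumℕ-cong (λ i → sumℕ-*ˡ (f i) g)) (sumℕ-*ʳ f (sumℕ g))

notZero : ∀ {t} → Fin t → ℕ
notZero zero    = 0
notZero (suc _) = 1

sumℕ-notZero : ∀ t → sumℕ {t} notZero ≡ t ∸ 1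
sumℕ-notZero zero    = ≡.refl
sumℕ-notZero (suc t) = ≡.trans (sumℕ-const t 1) (ℕ.*-identityʳ t)

sumℕ-notZero-product : ∀ m r → sumℕ {m} (λ i → sumℕ {r} (λ j → notZero i * notZero j)) ≡ (m ∸ 1) * (r ∸ 1)
sumℕ-notZero-product m r =
  ≡.trans (sumℕ-product {m} {r} notZero notZero) (≡.cong₂ _*_ (sumℕ-notZero m) (sumℕ-notZero r))

sumℕ-mono-≤ : ∀ {t} {f g : Fin t → ℕ} → (∀ i → f i ≤ g i) → sumℕ f ≤ sumℕ g
sumℕ-mono-≤ {zero}  f≤g = ℕ.≤-refl
sumℕ-mono-≤ {suc t} f≤g = ℕ.+-mono-≤ (f≤g zero) (sumℕ-mono-≤ (f≤g ∘ suc))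

prodℕ-mono-≤ : ∀ {t} {f g : Fin t → ℕ} → (∀ i → f i ≤ g i) → prodℕ f ≤ prodℕ g
prodℕ-mono-≤ {zero}  f≤g = ℕ.≤-refl
prodℕ-mono-≤ {suc t} f≤g = ℕ.*-mono-≤ (f≤g zero) (prodℕ-mono-≤ (f≤g ∘ suc))

^-sumℕ : ∀ {t} m (e : Fin t → ℕ) → m ^ sumℕ e ≡ prodℕ (λ i → m ^ e i)
^-sumℕ {zero}  m e = ≡.refl
^-sumℕ {suc t} m e = ≡.trans (ℕ.^-distribˡ-+-* m (e zero) _) (≡.cong (m ^ e zero *_) (^-sumℕ m (e ∘ suc)))

default≤maxℕ : ∀ {t} m (f : Fin t → ℕ) → m ≤ maxℕ m f
default≤maxℕ {zero}  m f = ℕ.≤-refl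
default≤maxℕ {suc t} m f = ℕ.≤-trans (default≤maxℕ m (f ∘ suc)) (ℕ.m≤n⊔m (f zero) _)

component≤maxℕ : ∀ {t} m (f : Fin t → ℕ) i → f i ≤ maxℕ m f
component≤maxℕ m f zero    = ℕ.m≤m⊔n (f zero) _
component≤maxℕ m f (suc i) = ℕ.≤-trans (component≤maxℕ m (f ∘ suc) i) (ℕ.m≤n⊔m (f zero) _)

-- direct q is a factor of size suc q, computed by the defining formula.
data Radix : Set where
  butterfly : Radix
  direct    : ℕ → Radix

radix : Radix → ℕ
radix butterfly  = 2
radix (direct q) = suc q

baseCost : Radix → ℕ
baseCost butterfly  = 2
baseCost (direct q) = q * q + suc q * q

weight : Radix → ℕ
weight butterfly  = 3
weight (direct q) = 4 * q

order : List Radix → ℕ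
order []      = 1
order (f ∷ L) = radix f * order L

weights : List Radix → ℕ
weights []      = 0
weights (f ∷ L) = weight f + weights L

fftCost : List Radix → ℕ
fftCost []      = 0
fftCost (f ∷ L) = (order L * baseCost f + (order L ∸ 1) * (radix f ∸ 1)) + radix f * fftCost L

radix-positive : ∀ f → 1 ≤ radix f
radix-positive butterfly  = s≤s z≤n
radix-positive (direct q) = s≤s z≤n

order-positive : ∀ L → 1 ≤ order L
order-positive []      = ℕ.≤-refl
order-positive (f ∷ L) = ℕ.*-mono-≤ (radix-positive f) (order-positive L)

order-++ : ∀ L L′ → order (L ++ L′) ≡ order L * order L′
order-++ []      L′ = ≡.sym (ℕ.+-identityʳ _)
order-++ (f ∷ L) L′ = ≡.trans (≡.cong (radix f *_) (order-++ L L′)) (≡.sym (ℕ.*-assoc (radix f) _ _))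

order-replicate : ∀ k f → order (replicate k f) ≡ radix f ^ k
order-replicate zero    f = ≡.refl
order-replicate (suc k) f = ≡.cong (radix f *_) (order-replicate k f)

weights-++ : ∀ L L′ → weights (L ++ L′) ≡ weights L + weights L′
weights-++ []      L′ = ≡.refl
weights-++ (f ∷ L) L′ = ≡.trans (≡.cong (weight f +_) (weights-++ L L′)) (≡.sym (ℕ.+-assoc (weight f) _ _))

weights-replicate : ∀ k f → weights (replicate k f) ≡ k * weight f
weights-replicate zero    f = ≡.refl
weights-replicate (suc k) f = ≡.cong (weight f +_) (weights-replicate k f)

base-invariant : ∀ f → 2 * baseCost f + 2 * radix f ≡ weight f * radix f + 2
base-invariant butterfly  = ≡.refl
base-invariant (direct q) = expand q
  where
  expand : ∀ q → 2 * (q * q + suc q * q) + 2 * suc q ≡ 4 * q * suc q + 2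
  expand = solve-∀

-- The invariant is stated with 2 n moved to the left so that no subtraction occurs.
fftCost-invariant-∷ : ∀ r m cᵣ cₘ w W → 1 ≤ r → 1 ≤ m →
  2 * cᵣ + 2 * r ≡ w * r + 2 → 2 * cₘ + 2 * m ≡ W * m + 2 →
  2 * ((m * cᵣ + (m ∸ 1) * (r ∸ 1)) + r * cₘ) + 2 * (r * m) ≡ (w + W) * (r * m) + 2
fftCost-invariant-∷ (suc r) (suc m) cᵣ cₘ w W _ _ hᵣ hₘ =
  ℕ.+-cancelʳ-≡ (2 * suc r + 2 * suc m) _ _ (begin
    2 * ((suc m * cᵣ + m * r) + suc r * cₘ) + 2 * (suc r * suc m) + (2 * suc r + 2 * suc m)
      ≡⟨ regroup r m cᵣ cₘ ⟩
    suc m * (2 * cᵣ + 2 * suc r) + suc r * (2 * cₘ + 2 * suc m) + 2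
      ≡⟨ ≡.cong₂ (λ u v → suc m * u + suc r * v + 2) hᵣ hₘ ⟩
    suc m * (w * suc r + 2) + suc r * (W * suc m + 2) + 2
      ≡⟨ collect r m w W ⟩
    (w + W) * (suc r * suc m) + 2 + (2 * suc r + 2 * suc m) ∎)
  where
  open ≡.≡-Reasoning
  regroup : ∀ r m cᵣ cₘ → 2 * ((suc m * cᵣ + m * r) + suc r * cₘ) + 2 * (suc r * suc m) + (2 * suc r + 2 * suc m)
                         ≡ suc m * (2 * cᵣ + 2 * suc r) + suc r * (2 * cₘ + 2 * suc m) + 2
  regroup = solve-∀
  collect : ∀ r m w W → suc m * (w * suc r + 2) + suc r * (W * suc m + 2) + 2
                       ≡ (w + W) * (suc r * suc m) + 2 + (2 * suc r + 2 * suc m)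
  collect = solve-∀

fftCost-invariant : ∀ L → 2 * fftCost L + 2 * order L ≡ weights L * order L + 2
fftCost-invariant []      = ≡.refl
fftCost-invariant (f ∷ L) =
  fftCost-invariant-∷ (radix f) (order L) (baseCost f) (fftCost L) (weight f) (weights L)
    (radix-positive f) (order-positive L) (base-invariant f) (fftCost-invariant L)

module RingLemmas {a ℓ} (A : Ring a ℓ) where
  open Ring A hiding (zero) renaming (_+_ to _⊕_; _*_ to _⊛_; _-_ to _⊖_)
  open SetoidReasoning setoid
  open SemiringSum semiring public using (sum; sum-cong-≋; ∑-comm; *-distribˡ-sum)

  sumR≡sum : ∀ {t} (f : Fin t → Carrier) → sumR A f ≡ sum f
  sumR≡sum {zero}  f = ≡.refl
  sumR≡sum {suc t} f = ≡.cong (f zero ⊕_) (sumR≡sum (f ∘ suc))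

  sum-splitAt : ∀ m k (f : Fin (m + k) → Carrier) →
                sum f ≈ sum (λ i → f (i ↑ˡ k)) ⊕ sum (λ j → f (m ↑ʳ j))
  sum-splitAt zero    k f = sym (+-identityˡ _)
  sum-splitAt (suc m) k f = trans (+-congˡ (sum-splitAt m k (f ∘ suc))) (sym (+-assoc _ _ _))

  sum-combine : ∀ r m (f : Fin (r * m) → Carrier) → sum f ≈ sum {r} (λ a → sum {m} (λ b → f (combine a b)))
  sum-combine zero    m f = refl
  sum-combine (suc r) m f = trans (sum-splitAt m (r * m) f) (+-congˡ (sum-combine r m (λ j → f (m ↑ʳ j))))

  pow-+-* : ∀ x i j y → pow A x (i + j) ⊛ y ≈ pow A x i ⊛ (pow A x j ⊛ y)
  pow-+-* x zero    j y = sym (*-identityˡ _)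
  pow-+-* x (suc i) j y = trans (*-assoc x _ y) (trans (*-congˡ (pow-+-* x i j y)) (sym (*-assoc x _ _)))

  pow-periodic : ∀ {x N} → pow A x N ≈ 1# → ∀ t e y → pow A x (N * t + e) ⊛ y ≈ pow A x e ⊛ y
  pow-periodic {x} {N} x^N≈1 zero    e y = reflexive (≡.cong (λ k → pow A x (k + e) ⊛ y) (ℕ.*-zeroʳ N))
  pow-periodic {x} {N} x^N≈1 (suc t) e y = begin
    pow A x (N * suc t + e) ⊛ y           ≡⟨ ≡.cong (λ k → pow A x k ⊛ y) (unfold N t e) ⟩
    pow A x (N + (N * t + e)) ⊛ y         ≈⟨ pow-+-* x N _ y ⟩
    pow A x N ⊛ (pow A x (N * t + e) ⊛ y) ≈⟨ *-cong x^N≈1 (pow-periodic {x} {N} x^N≈1 t e y) ⟩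
    1# ⊛ (pow A x e ⊛ y)                  ≈⟨ *-identityˡ _ ⟩
    pow A x e ⊛ y                         ∎
    where
    unfold : ∀ N t e → N * suc t + e ≡ N + (N * t + e)
    unfold = solve-∀

  x²≈1⇒[1-x][1+x]≈0 : ∀ x → x ⊛ x ≈ 1# → (1# ⊖ x) ⊛ (1# ⊕ x) ≈ 0#
  x²≈1⇒[1-x][1+x]≈0 x x²≈1 = begin
    (1# ⊖ x) ⊛ (1# ⊕ x)             ≈⟨ RingProperties.[y-z]x≈yx-zx A (1# ⊕ x) 1# x ⟩
    1# ⊛ (1# ⊕ x) ⊖ x ⊛ (1# ⊕ x)    ≈⟨ +-cong (*-identityˡ _) (-‿cong (distribˡ x 1# x)) ⟩
    (1# ⊕ x) ⊖ (x ⊛ 1# ⊕ x ⊛ x)     ≈⟨ +-congˡ (-‿cong (+-cong (*-identityʳ x) x²≈1)) ⟩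
    (1# ⊕ x) ⊖ (x ⊕ 1#)             ≈⟨ +-congˡ (-‿cong (+-comm x 1#)) ⟩
    (1# ⊕ x) ⊖ (1# ⊕ x)             ≈⟨ -‿inverseʳ _ ⟩
    0#                              ∎

module StraightLine {a ℓ} (A : Ring a ℓ) (ω : Ring.Carrier A) where
  open Ring A hiding (zero) renaming (_+_ to _⊕_; _*_ to _⊛_; _-_ to _⊖_)

  data Code : ℕ → ℕ → Set where
    []  : ∀ {k} → Code k k
    _∷_ : ∀ {k k′} → Instr k → Code (suc k) k′ → Code k k′

  length : ∀ {k k′} → Code k k′ → ℕ
  length []      = 0
  length (_ ∷ c) = suc (length c)

  _⨾_ : ∀ {k k′ k″} → Code k k′ → Code k′ k″ → Code k k″
  []      ⨾ d = d
  (ι ∷ c) ⨾ d = ι ∷ (c ⨾ d)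

  length-⨾ : ∀ {k k′ k″} (c : Code k k′) (d : Code k′ k″) → length (c ⨾ d) ≡ length c + length d
  length-⨾ []      d = ≡.refl
  length-⨾ (ι ∷ c) d = ≡.cong suc (length-⨾ c d)

  exec : ∀ {k k′} → Code k k′ → (Fin k → Carrier) → Fin k′ → Carrier
  exec []      env = env
  exec (ι ∷ c) env = exec c (extend A (execInstr A ω ι env) env)

  exec-⨾ : ∀ {k k′ k″} (c : Code k k′) (d : Code k′ k″) env j → exec (c ⨾ d) env j ≡ exec d (exec c env) j
  exec-⨾ []      d env j = ≡.refl
  exec-⨾ (ι ∷ c) d env j = exec-⨾ c d _ j

  shift : ∀ {k k′} → Code k k′ → Fin k → Fin k′
  shift []      j = j
  shift (ι ∷ c) j = shift c (suc j)

  exec-shift : ∀ {k k′} (c : Code k k′) env j → exec c env (shift c j) ≡ env j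
  exec-shift []      env j = ≡.refl
  exec-shift (ι ∷ c) env j = exec-shift c _ (suc j)

  toSLP : ∀ {m k k′} → Code k k′ → (Fin m → Fin k′) → SLP m k
  toSLP []      out = ret out
  toSLP (ι ∷ c) out = step ι (toSLP c out)

  run-toSLP : ∀ {m k k′} (c : Code k k′) (out : Fin m → Fin k′) env o →
              run A ω (toSLP c out) env o ≡ exec c env (out o)
  run-toSLP []      out env o = ≡.refl
  run-toSLP (ι ∷ c) out env o = run-toSLP c out _ o

  cost-toSLP : ∀ {m k k′} (c : Code k k′) (out : Fin m → Fin k′) → cost (toSLP c out) ≡ length c
  cost-toSLP []      out = ≡.refl
  cost-toSLP (ι ∷ c) out = ≡.cong suc (cost-toSLP c out)

  Spec : Set → Set → Set a
  Spec I O = (I → Carrier) → O → Carrier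

  record Emitted (O : Set) (k : ℕ) : Set where
    constructor emitted
    field
      {registers} : ℕ
      code        : Code k registers
      output      : O → Fin registers
  open Emitted public

  -- A fragment computes f with exactly c operations, wherever its inputs are stored.
  record Fragment (I O : Set) (f : Spec I O) (c : ℕ) : Set (a ⊔ ℓ) where
    field
      emit         : ∀ {k} → (I → Fin k) → Emitted O k
      length-emit  : ∀ {k} (ι : I → Fin k) → length (code (emit ι)) ≡ c
      emit-correct : ∀ {k} (ι : I → Fin k) env o → exec (code (emit ι)) env (output (emit ι) o) ≈ f (env ∘ ι) o
      spec-cong    : ∀ x y → (∀ i → x i ≈ y i) → ∀ o → f x o ≈ f y o
  open Fragment public

  resp-spec : ∀ {I O} {f g : Spec I O} {c} → (∀ x o → f x o ≈ g x o) → Fragment I O f c → Fragment I O g c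
  resp-spec f≈g F = record
    { emit         = emit F
    ; length-emit  = length-emit F
    ; emit-correct = λ ι env o → trans (emit-correct F ι env o) (f≈g _ o)
    ; spec-cong    = λ x y x≈y o → trans (sym (f≈g x o)) (trans (spec-cong F x y x≈y o) (f≈g y o))
    }

  resp-cost : ∀ {I O} {f : Spec I O} {c c′} → c ≡ c′ → Fragment I O f c → Fragment I O f c′
  resp-cost ≡.refl F = F

  relabel : ∀ {I O I′ O′} {f : Spec I O} {c} (h : I → I′) (k : O′ → O) →
            Fragment I O f c → Fragment I′ O′ (λ x o → f (x ∘ h) (k o)) c
  relabel h k F = record
    { emit         = λ ι → emitted (code (emit F (ι ∘ h))) (output (emit F (ι ∘ h)) ∘ k)
    ; length-emit  = λ ι → length-emit F (ι ∘ h)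
    ; emit-correct = λ ι env o → emit-correct F (ι ∘ h) env (k o)
    ; spec-cong    = λ x y x≈y o → spec-cong F _ _ (x≈y ∘ h) (k o)
    }

  infixl 5 _⟫_
  _⟫_ : ∀ {I M O} {f : Spec I M} {g : Spec M O} {c d} →
        Fragment I M f c → Fragment M O g d → Fragment I O (λ x → g (f x)) (c + d)
  _⟫_ {I} {O = O} F G = record
    { emit         = emitFG
    ; length-emit  = λ ι → ≡.trans (length-⨾ (code (emit F ι)) _) (≡.cong₂ _+_ (length-emit F ι) (length-emit G _))
    ; emit-correct = λ ι env o → trans (reflexive (exec-⨾ (code (emit F ι)) _ env _))
                                   (trans (emit-correct G (output (emit F ι)) _ o)
                                          (spec-cong G _ _ (emit-correct F ι env) o))
    ; spec-cong    = λ x y x≈y → spec-cong G _ _ (spec-cong F x y x≈y)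
    }
    where
    emitFG : ∀ {k} → (I → Fin k) → Emitted O k
    emitFG ι = emitted (code (emit F ι) ⨾ code (emit G (output (emit F ι))))
                       (output (emit G (output (emit F ι))))

  parallel : ∀ {I O} m {f : Fin m → Spec I O} {c : Fin m → ℕ} → (∀ j → Fragment I O (f j) (c j)) →
             Fragment I (Fin m × O) (λ x p → f (proj₁ p) x (proj₂ p)) (sumℕ c)
  parallel zero F = record
    { emit         = λ ι → emitted [] (λ { (() , _) })
    ; length-emit  = λ ι → ≡.refl
    ; emit-correct = λ { ι env (() , _) }
    ; spec-cong    = λ { x y x≈y (() , _) }
    }
  parallel {I} {O} (suc m) {f} {c} F = record
    { emit         = emitAll
    ; length-emit  = λ ι → ≡.trans (length-⨾ (code (emit (F zero) ι)) _)
                                   (≡.cong₂ _+_ (length-emit (F zero) ι) (length-emit rest _))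
    ; emit-correct = correct
    ; spec-cong    = λ { x y x≈y (j , o) → spec-cong (F j) x y x≈y o }
    }
    where
    rest : Fragment I (Fin m × O) (λ x p → f (suc (proj₁ p)) x (proj₂ p)) (sumℕ (c ∘ suc))
    rest = parallel m (F ∘ suc)
    emitAll : ∀ {k} → (I → Fin k) → Emitted (Fin (suc m) × O) k
    emitAll {k} ι = emitted (code first ⨾ code others) out
      where
      first : Emitted O k
      first = emit (F zero) ι
      others : Emitted (Fin m × O) (registers first)
      others = emit rest (shift (code first) ∘ ι)
      out : Fin (suc m) × O → Fin (registers others)
      out (zero  , o) = shift (code others) (output first o)
      out (suc j , o) = output others (j , o)
    correct : ∀ {k} ι env p → exec (code (emitAll {k} ι)) env (output (emitAll ι) p) ≈ f (proj₁ p) (env ∘ ι) (proj₂ p)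
    correct ι env (zero , o) =
      trans (reflexive (exec-⨾ (code (emit (F zero) ι)) _ env _))
            (trans (reflexive (exec-shift (code (emit rest _)) _ _)) (emit-correct (F zero) ι env o))
    correct ι env (suc j , o) =
      trans (reflexive (exec-⨾ (code (emit (F zero) ι)) _ env _))
            (trans (emit-correct rest _ _ (j , o))
                   (spec-cong (F (suc j)) _ _ (λ i → reflexive (exec-shift (code (emit (F zero) ι)) env (ι i))) o))

  either : ∀ {b} {X : Set b} → X → X → Fin 2 → X
  either u v zero    = u
  either u v (suc _) = v

  pairᶠ : ∀ {I O} {f g : Spec I O} {c d} → Fragment I O f c → Fragment I O g d →
          Fragment I (Fin 2 × O) (λ x p → either f g (proj₁ p) x (proj₂ p)) (c + (d + 0))
  pairᶠ {f = f} {g} {c} {d} F G = parallel 2 {f = either f g} {c = either c d} λ { zero → F ; (suc zero) → G }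

  idᶠ : ∀ {I} → Fragment I I (λ x → x) 0
  idᶠ = record
    { emit = λ ι → emitted [] ι ; length-emit = λ _ → ≡.refl
    ; emit-correct = λ _ _ _ → refl ; spec-cong = λ _ _ x≈y → x≈y }

  addᶠ : Fragment (Fin 2) ⊤ (λ x _ → x zero ⊕ x (suc zero)) 1
  addᶠ = record
    { emit = λ ι → emitted (add (ι zero) (ι (suc zero)) ∷ []) (λ _ → zero) ; length-emit = λ _ → ≡.refl
    ; emit-correct = λ _ _ _ → refl ; spec-cong = λ x y x≈y _ → +-cong (x≈y zero) (x≈y (suc zero)) }

  subᶠ : Fragment (Fin 2) ⊤ (λ x _ → x zero ⊖ x (suc zero)) 1
  subᶠ = record
    { emit = λ ι → emitted (sub (ι zero) (ι (suc zero)) ∷ []) (λ _ → zero) ; length-emit = λ _ → ≡.refl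
    ; emit-correct = λ _ _ _ → refl ; spec-cong = λ x y x≈y _ → +-cong (x≈y zero) (-‿cong (x≈y (suc zero))) }

  mulωᶠ : ∀ e → Fragment ⊤ ⊤ (λ x _ → pow A ω e ⊛ x tt) 1
  mulωᶠ e = record
    { emit = λ ι → emitted (mulω e (ι tt) ∷ []) (λ _ → zero) ; length-emit = λ _ → ≡.refl
    ; emit-correct = λ _ _ _ → refl ; spec-cong = λ x y x≈y _ → *-congˡ (x≈y tt) }

digits : ∀ r m → Fin (r * m) → Fin r × Fin m
digits r m i = proj₂ qr , proj₁ qr
  where
  qr : Fin m × Fin r
  qr = remQuot {m} r (cast (ℕ.*-comm r m) i)

toℕ-digits : ∀ r m (i : Fin (r * m)) → toℕ i ≡ toℕ (proj₁ (digits r m i)) + r * toℕ (proj₂ (digits r m i))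
toℕ-digits r m i = begin
  toℕ i                     ≡⟨ toℕ-cast (ℕ.*-comm r m) i ⟨
  toℕ j                     ≡⟨ ≡.cong toℕ (combine-remQuot {m} r j) ⟨
  toℕ (combine i₂ i₁)       ≡⟨ toℕ-combine i₂ i₁ ⟩
  r * toℕ i₂ + toℕ i₁       ≡⟨ ℕ.+-comm (r * toℕ i₂) _ ⟩
  toℕ i₁ + r * toℕ i₂       ∎
  where
  open ≡.≡-Reasoning
  j : Fin (m * r)
  j  = cast (ℕ.*-comm r m) i
  i₂ : Fin m
  i₂ = proj₁ (remQuot {m} r j)
  i₁ : Fin r
  i₁ = proj₂ (remQuot {m} r j)

module Fourier {a ℓ} (A : Ring a ℓ) (ω : Ring.Carrier A) where
  open Ring A hiding (zero) renaming (_+_ to _⊕_; _*_ to _⊛_; _-_ to _⊖_)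
  open RingLemmas A
  open StraightLine A ω
  open SetoidReasoning setoid

  infix 9 ω^_
  ω^_ : ℕ → Carrier
  ω^ e = pow A ω e

  dft : ℕ → (n : ℕ) → Spec (Fin n) (Fin n)
  dft s n x i = sum (λ ν → ω^ (s * (toℕ i * toℕ ν)) ⊛ x ν)

  ω^0-* : ∀ {e} → e ≡ 0 → ∀ y → y ≈ ω^ e ⊛ y
  ω^0-* ≡.refl y = sym (*-identityˡ y)

  powerᶠ : ∀ {m r} s (i : Fin m) (j : Fin r) →
           Fragment ⊤ ⊤ (λ x _ → ω^ (s * (toℕ i * toℕ j)) ⊛ x tt) (notZero i * notZero j)
  powerᶠ s zero    j       = resp-spec (λ x _ → ω^0-* (ℕ.*-zeroʳ s) _) idᶠ
  powerᶠ s (suc i) zero    =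
    resp-spec (λ x _ → ω^0-* (≡.trans (≡.cong (s *_) (ℕ.*-zeroʳ (toℕ i))) (ℕ.*-zeroʳ s)) _) idᶠ
  powerᶠ s (suc i) (suc j) = mulωᶠ (s * (toℕ (suc i) * toℕ (suc j)))

  sumᶠ : ∀ t → Fragment (Fin (suc t)) ⊤ (λ x _ → sum x) t
  sumᶠ zero    = resp-spec (λ x _ → sym (+-identityʳ _)) (relabel (λ _ → zero) (λ _ → tt) (idᶠ {⊤}))
  sumᶠ (suc t) = resp-cost (≡.trans (ℕ.+-comm (t + 0) 1) (≡.cong suc (ℕ.+-identityʳ t)))
    (pairᶠ (relabel (λ _ → zero) (λ _ → tt) (idᶠ {⊤})) (relabel suc id (sumᶠ t))
      ⟫ relabel (λ j → j , tt) id addᶠ)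

  rowᶠ : ∀ q s (i : Fin (suc q)) →
         Fragment (Fin (suc q)) ⊤ (λ x _ → dft s (suc q) x i) (sumℕ {suc q} (λ ν → notZero i * notZero ν) + q)
  rowᶠ q s i = relabel id (λ ν → ν , tt) (parallel (suc q) (λ ν → relabel (λ _ → ν) id (powerᶠ s i ν)))
             ⟫ sumᶠ q

  directᶠ : ∀ q s → Fragment (Fin (suc q)) (Fin (suc q)) (dft s (suc q)) (q * q + suc q * q)
  directᶠ q s = resp-cost cost≡ (relabel id (λ i → i , tt) (parallel (suc q) {c = rowCost} (rowᶠ q s)))
    where
    rowCost : Fin (suc q) → ℕ
    rowCost i = sumℕ {suc q} (λ ν → notZero i * notZero ν) + q
    cost≡ : sumℕ rowCost ≡ q * q + suc q * q
    cost≡ = ≡.trans (sumℕ-+ {suc q} (λ i → sumℕ {suc q} (λ ν → notZero i * notZero ν)) (λ _ → q))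
                    (≡.cong₂ _+_ (sumℕ-notZero-product (suc q) (suc q)) (sumℕ-const (suc q) q))

  butterflyᶠ : ∀ s → ω^ s ≈ - 1# → Fragment (Fin 2) (Fin 2) (dft s 2) 2
  butterflyᶠ s ω^s≈-1 = resp-spec outputs (relabel id (λ i → i , tt) (pairᶠ addᶠ subᶠ))
    where
    outputs : ∀ x i → either (λ x _ → x zero ⊕ x (suc zero)) (λ x _ → x zero ⊖ x (suc zero)) i x tt ≈ dft s 2 x i
    outputs x zero       = +-cong (ω^0-* (ℕ.*-zeroʳ s) _) (trans (ω^0-* (ℕ.*-zeroʳ s) _) (sym (+-identityʳ _)))
    outputs x (suc zero) = +-cong (ω^0-* (ℕ.*-zeroʳ s) _) (begin
      - x (suc zero)                     ≈⟨ RingProperties.-1*x≈-x A _ ⟨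
      - 1# ⊛ x (suc zero)                ≈⟨ *-congʳ ω^s≈-1 ⟨
      ω^ s ⊛ x (suc zero)                ≡⟨ ≡.cong (λ e → ω^ e ⊛ x (suc zero)) (ℕ.*-identityʳ s) ⟨
      ω^ (s * 1) ⊛ x (suc zero)          ≈⟨ +-identityʳ _ ⟨
      ω^ (s * 1) ⊛ x (suc zero) ⊕ 0#     ∎)

  module _ (N : ℕ) (ω^N≈1 : ω^ N ≈ 1#) (ω^half≈-1 : ∀ s → s * 2 ≡ N → ω^ s ≈ - 1#) where

    twiddle-split : ∀ {r m s} → s * (r * m) ≡ N →
                    ∀ {i i₁ i₂ ν a b} → i ≡ i₁ + r * i₂ → ν ≡ m * a + b → ∀ y →
      ω^ (s * (i * ν)) ⊛ y ≈ ω^ (s * r * (i₂ * b)) ⊛ (ω^ (s * (b * i₁)) ⊛ (ω^ (s * m * (i₁ * a)) ⊛ y))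
    twiddle-split {r} {m} {s} s*rm≡N {i} {i₁} {i₂} {ν} {a} {b} i≡ ν≡ y = begin
      ω^ (s * (i * ν)) ⊛ y                    ≡⟨ ≡.cong (λ e → ω^ e ⊛ y) exponent ⟩
      ω^ (N * (i₂ * a) + (e₂ + (e₁ + e₃))) ⊛ y ≈⟨ pow-periodic {ω} {N} ω^N≈1 (i₂ * a) _ y ⟩
      ω^ (e₂ + (e₁ + e₃)) ⊛ y                  ≈⟨ pow-+-* ω e₂ _ y ⟩
      ω^ e₂ ⊛ (ω^ (e₁ + e₃) ⊛ y)               ≈⟨ *-congˡ (pow-+-* ω e₁ e₃ y) ⟩
      ω^ e₂ ⊛ (ω^ e₁ ⊛ (ω^ e₃ ⊛ y))            ∎
      where
      e₁ e₂ e₃ : ℕ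
      e₁ = s * (b * i₁)
      e₂ = s * r * (i₂ * b)
      e₃ = s * m * (i₁ * a)
      expand : ∀ s r m i₁ i₂ a b → s * ((i₁ + r * i₂) * (m * a + b))
             ≡ s * (r * m) * (i₂ * a) + (s * r * (i₂ * b) + (s * (b * i₁) + s * m * (i₁ * a)))
      expand = solve-∀
      exponent : s * (i * ν) ≡ N * (i₂ * a) + (e₂ + (e₁ + e₃))
      exponent = ≡.trans (≡.cong₂ (λ u v → s * (u * v)) i≡ ν≡)
                 (≡.trans (expand s r m i₁ i₂ a b) (≡.cong (λ k → k * (i₂ * a) + (e₂ + (e₁ + e₃))) s*rm≡N))

    cooley-tukey : ∀ r m s → s * (r * m) ≡ N → (x : Fin (r * m) → Carrier)
                   (i : Fin (r * m)) (i₁ : Fin r) (i₂ : Fin m) → toℕ i ≡ toℕ i₁ + r * toℕ i₂ →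
      dft (s * r) m (λ b → ω^ (s * (toℕ b * toℕ i₁)) ⊛ dft (s * m) r (λ a → x (combine a b)) i₁) i₂
      ≈ dft s (r * m) x i
    cooley-tukey r m s s*rm≡N x i i₁ i₂ i≡ = sym (begin
      sum term                                  ≈⟨ sum-combine r m term ⟩
      sum {r} (λ a → sum {m} (λ b → term (combine a b))) ≈⟨ ∑-comm {r} {m} (λ a b → term (combine a b)) ⟩
      sum {m} (λ b → sum {r} (λ a → term (combine a b))) ≈⟨ sum-cong-≋ {m} column ⟩
      _                                          ∎)
      where
      term : Fin (r * m) → Carrier
      term ν = ω^ (s * (toℕ i * toℕ ν)) ⊛ x ν
      column : ∀ b → sum {r} (λ a → term (combine a b))
             ≈ ω^ (s * r * (toℕ i₂ * toℕ b))
               ⊛ (ω^ (s * (toℕ b * toℕ i₁)) ⊛ dft (s * m) r (λ a → x (combine a b)) i₁)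
      column b = begin
        sum {r} (λ a → term (combine a b))
          ≈⟨ sum-cong-≋ {r} (λ a → twiddle-split {r} {m} {s} s*rm≡N {i₁ = toℕ i₁} {toℕ i₂} {a = toℕ a} {toℕ b}
                                          i≡ (toℕ-combine a b) (x (combine a b))) ⟩
        sum {r} (λ a → ω^ e₂ ⊛ (ω^ e₁ ⊛ (ω^ (s * m * (toℕ i₁ * toℕ a)) ⊛ x (combine a b))))
          ≈⟨ *-distribˡ-sum {r} (ω^ e₂) _ ⟨
        ω^ e₂ ⊛ sum {r} (λ a → ω^ e₁ ⊛ (ω^ (s * m * (toℕ i₁ * toℕ a)) ⊛ x (combine a b)))
          ≈⟨ *-congˡ (*-distribˡ-sum {r} (ω^ e₁) _) ⟨
        ω^ e₂ ⊛ (ω^ e₁ ⊛ dft (s * m) r (λ a → x (combine a b)) i₁) ∎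
        where
        e₁ e₂ : ℕ
        e₁ = s * (toℕ b * toℕ i₁)
        e₂ = s * r * (toℕ i₂ * toℕ b)

    radixᶠ : ∀ f s → s * radix f ≡ N → Fragment (Fin (radix f)) (Fin (radix f)) (dft s (radix f)) (baseCost f)
    radixᶠ butterfly  s s*2≡N = butterflyᶠ s (ω^half≈-1 s s*2≡N)
    radixᶠ (direct q) s _     = directᶠ q s

    fftᶠ : ∀ L s → s * order L ≡ N → Fragment (Fin (order L)) (Fin (order L)) (dft s (order L)) (fftCost L)
    fftᶠ []      s _      = resp-spec (λ { x zero → trans (ω^0-* (ℕ.*-zeroʳ s) _) (sym (+-identityʳ _)) }) idᶠ
    fftᶠ (f ∷ L) s s*n≡N = resp-cost cost≡
      (resp-spec (λ x i → cooley-tukey r m s s*n≡N x i _ _ (toℕ-digits r m i))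
        (relabel (λ (b , a) → combine a b) (digits r m) (columns ⟫ twiddles ⟫ rows)))
      where
      r m : ℕ
      r = radix f
      m = order L
      columns : Fragment (Fin m × Fin r) (Fin m × Fin r)
                  (λ x p → dft (s * m) r (λ a → x (proj₁ p , a)) (proj₂ p)) (sumℕ {m} (λ _ → baseCost f))
      columns = parallel m (λ b → relabel (λ a → b , a) id
                  (radixᶠ f (s * m) (≡.trans (ℕ.*-assoc s m r) (≡.trans (≡.cong (s *_) (ℕ.*-comm m r)) s*n≡N))))
      twiddles : Fragment (Fin m × Fin r) (Fin m × Fin r)
                   (λ y p → ω^ (s * (toℕ (proj₁ p) * toℕ (proj₂ p))) ⊛ y p)
                   (sumℕ {m} (λ b → sumℕ {r} (λ i₁ → notZero b * notZero i₁)))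
      twiddles = relabel id (λ (b , i₁) → b , i₁ , tt)
                   (parallel m (λ b → parallel r (λ i₁ → relabel (λ _ → b , i₁) id (powerᶠ s b i₁))))
      rows : Fragment (Fin m × Fin r) (Fin r × Fin m)
               (λ z p → dft (s * r) m (λ b → z (b , proj₁ p)) (proj₂ p)) (sumℕ {r} (λ _ → fftCost L))
      rows = parallel r (λ i₁ → relabel (λ b → b , i₁) id (fftᶠ L (s * r) (≡.trans (ℕ.*-assoc s r m) s*n≡N)))
      cost≡ : sumℕ {m} (λ _ → baseCost f) + sumℕ {m} (λ b → sumℕ {r} (λ i₁ → notZero b * notZero i₁))
              + sumℕ {r} (λ _ → fftCost L) ≡ fftCost (f ∷ L)
      cost≡ = ≡.cong₂ _+_ (≡.cong₂ _+_ (sumℕ-const m (baseCost f)) (sumℕ-notZero-product m r))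
                          (sumℕ-const r (fftCost L))

half-power≈-1 : ∀ {a ℓ} (A : Ring a ℓ) {ω n} → 1 ≤ n → IsPrincipalRoot A n ω →
                ∀ s → s * 2 ≡ n → Ring._≈_ A (pow A ω s) (Ring.-_ A (Ring.1# A))
half-power≈-1 A () _ zero ≡.refl
half-power≈-1 A {ω} {n} 1≤n (ω^n≈1 , 1-ω^ν-regular) s@(suc _) s*2≡n =
  GroupProperties.inverseʳ-unique +-group 1# w
    (proj₁ (1-ω^ν-regular s 1≤s s<n (1# ⊕ w)) (x²≈1⇒[1-x][1+x]≈0 w w²≈1))
  where
  open Ring A hiding (zero) renaming (_+_ to _⊕_; _*_ to _⊛_; _-_ to _⊖_)
  open RingLemmas A
  w : Carrier
  w = pow A ω s
  s+s≡n : s + s ≡ n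
  s+s≡n = ≡.trans (≡.cong (s +_) (≡.sym (ℕ.+-identityʳ s))) (≡.trans (ℕ.*-comm 2 s) s*2≡n)
  1≤s : 1 ≤ s
  1≤s = s≤s z≤n
  s<n : s < n
  s<n = ≡.subst (s <_) s+s≡n (ℕ.m<m+n s 1≤s)
  w²≈1 : w ⊛ w ≈ 1#
  w²≈1 = begin
    w ⊛ w                ≈⟨ *-congˡ (*-identityʳ w) ⟨
    w ⊛ (w ⊛ 1#)         ≈⟨ pow-+-* ω s s 1# ⟨
    pow A ω (s + s) ⊛ 1# ≈⟨ *-identityʳ _ ⟩
    pow A ω (s + s)      ≡⟨ ≡.cong (pow A ω) s+s≡n ⟩
    pow A ω n            ≈⟨ ω^n≈1 ⟩
    1#                   ∎
    where open SetoidReasoning setoid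

fft-program : ∀ {a ℓ} (A : Ring a ℓ) (ω : Ring.Carrier A) (L : List Radix) {n} → order L ≡ n →
              IsPrincipalRoot A n ω → Σ (SLP n n) λ P → ComputesDFT A n ω P × cost P ≡ fftCost L
fft-program A ω L ≡.refl root@(ω^n≈1 , _) =
  toSLP (code E) (output E) , computes , ≡.trans (cost-toSLP (code E) (output E)) (length-emit F id)
  where
  open Ring A hiding (zero) renaming (_+_ to _⊕_; _*_ to _⊛_; _-_ to _⊖_)
  open SetoidReasoning setoid
  open RingLemmas A
  open StraightLine A ω
  open Fourier A ω
  F : Fragment (Fin (order L)) (Fin (order L)) (dft 1 (order L)) (fftCost L)
  F = fftᶠ (order L) ω^n≈1 (half-power≈-1 A (order-positive L) root) L 1 (ℕ.*-identityˡ _)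
  E : Emitted (Fin (order L)) (order L)
  E = emit F id
  computes : ComputesDFT A (order L) ω (toSLP (code E) (output E))
  computes x i = begin
    run A ω (toSLP (code E) (output E)) x i ≡⟨ run-toSLP (code E) (output E) x i ⟩
    exec (code E) x (output E i)            ≈⟨ emit-correct F id x i ⟩
    dft 1 (order L) x i                     ≈⟨ sum-cong-≋ {order L} (λ ν → reflexive
                                                 (≡.cong (λ e → ω^ e ⊛ x ν) (ℕ.*-identityˡ (toℕ i * toℕ ν)))) ⟩
    sum (λ ν → ω^ (toℕ i * toℕ ν) ⊛ x ν)    ≡⟨ sumR≡sum {order L} (λ ν → ω^ (toℕ i * toℕ ν) ⊛ x ν) ⟨
    DFT A (order L) ω x i                   ∎

oddPlan : ∀ {t} → (Fin t → ℕ) → (Fin t → ℕ) → List Radix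
oddPlan {zero}  q e = []
oddPlan {suc t} q e = replicate (e zero) (direct (q zero ∸ 1)) ++ oddPlan (q ∘ suc) (e ∘ suc)

plan : ∀ {t} → ℕ → (Fin t → ℕ) → (Fin t → ℕ) → List Radix
plan d₁ q e = replicate d₁ butterfly ++ oddPlan q e

order-oddPlan : ∀ {t} (q e : Fin t → ℕ) → (∀ i → 1 ≤ q i) → order (oddPlan q e) ≡ prodℕ (λ i → q i ^ e i)
order-oddPlan {zero}  q e 1≤q = ≡.refl
order-oddPlan {suc t} q e 1≤q =
  ≡.trans (order-++ (replicate (e zero) (direct (q zero ∸ 1))) _)
          (≡.cong₂ _*_ (≡.trans (order-replicate (e zero) _) (≡.cong (_^ e zero) (suc[p∸1]≡p (1≤q zero))))
                       (order-oddPlan (q ∘ suc) (e ∘ suc) (1≤q ∘ suc)))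
  where
  suc[p∸1]≡p : ∀ {p} → 1 ≤ p → suc (p ∸ 1) ≡ p
  suc[p∸1]≡p (s≤s z≤n) = ≡.refl

weights-oddPlan : ∀ {t} (q e : Fin t → ℕ) → weights (oddPlan q e) ≡ 4 * sumℕ (λ i → e i * (q i ∸ 1))
weights-oddPlan {zero}  q e = ≡.refl
weights-oddPlan {suc t} q e =
  ≡.trans (weights-++ (replicate (e zero) (direct (q zero ∸ 1))) _)
          (≡.trans (≡.cong₂ _+_ (weights-replicate (e zero) _) (weights-oddPlan (q ∘ suc) (e ∘ suc)))
                   (factor (e zero) (q zero ∸ 1) _))
  where
  factor : ∀ k p S → k * (4 * p) + 4 * S ≡ 4 * (k * p + S)
  factor = solve-∀

order-plan : ∀ {t} d₁ (q e : Fin t → ℕ) → (∀ i → 1 ≤ q i) →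
             order (plan d₁ q e) ≡ 2 ^ d₁ * prodℕ (λ i → q i ^ e i)
order-plan d₁ q e 1≤q = ≡.trans (order-++ (replicate d₁ butterfly) _)
                                (≡.cong₂ _*_ (order-replicate d₁ butterfly) (order-oddPlan q e 1≤q))

weights-plan : ∀ {t} d₁ (q e : Fin t → ℕ) → weights (plan d₁ q e) ≡ 3 * d₁ + 4 * sumℕ (λ i → e i * (q i ∸ 1))
weights-plan d₁ q e = ≡.trans (weights-++ (replicate d₁ butterfly) _)
                              (≡.cong₂ _+_ (≡.trans (weights-replicate d₁ butterfly) (ℕ.*-comm d₁ 3)) (weights-oddPlan q e))

weight-bound : ∀ {t} d₁ (q e : Fin t → ℕ) →
                 3 * d₁ + 4 * sumℕ (λ i → e i * (q i ∸ 1)) ≤ 4 * maxℕ 2 q * (d₁ + sumℕ e)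
weight-bound d₁ q e = begin
  3 * d₁ + 4 * sumℕ (λ i → e i * (q i ∸ 1))
    ≤⟨ ℕ.+-mono-≤ (ℕ.*-monoˡ-≤ d₁ 3≤4M) (ℕ.*-monoʳ-≤ 4 (sumℕ-mono-≤ (λ i → ℕ.*-monoʳ-≤ (e i) (q∸1≤M i)))) ⟩
  4 * M * d₁ + 4 * sumℕ (λ i → e i * M)
    ≡⟨ ≡.cong (λ S → 4 * M * d₁ + 4 * S) (sumℕ-*ʳ e M) ⟩
  4 * M * d₁ + 4 * (sumℕ e * M)
    ≡⟨ collect M d₁ (sumℕ e) ⟩
  4 * M * (d₁ + sumℕ e) ∎
  where
  open ℕ.≤-Reasoning
  M : ℕ
  M = maxℕ 2 q
  3≤4M : 3 ≤ 4 * M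
  3≤4M = ℕ.≤-trans (ℕ.m≤m+n 3 5) (ℕ.*-monoʳ-≤ 4 (default≤maxℕ 2 q))
  q∸1≤M : ∀ i → q i ∸ 1 ≤ M
  q∸1≤M i = ℕ.≤-trans (ℕ.m∸n≤m (q i) 1) (component≤maxℕ 2 q i)
  collect : ∀ M d S → 4 * M * d + 4 * (S * M) ≡ 4 * M * (d + S)
  collect = solve-∀

2^length≤order : ∀ {t} d₁ (q e : Fin t → ℕ) → (∀ i → 2 ≤ q i) →
                 2 ^ (d₁ + sumℕ e) ≤ 2 ^ d₁ * prodℕ (λ i → q i ^ e i)
2^length≤order d₁ q e 2≤q = begin
  2 ^ (d₁ + sumℕ e)              ≡⟨ ℕ.^-distribˡ-+-* 2 d₁ (sumℕ e) ⟩
  2 ^ d₁ * 2 ^ sumℕ e            ≡⟨ ≡.cong (2 ^ d₁ *_) (^-sumℕ 2 e) ⟩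
  2 ^ d₁ * prodℕ (λ i → 2 ^ e i) ≤⟨ ℕ.*-monoʳ-≤ (2 ^ d₁) (prodℕ-mono-≤ (λ i → ℕ.^-monoˡ-≤ (e i) (2≤q i))) ⟩
  2 ^ d₁ * prodℕ (λ i → q i ^ e i) ∎
  where open ℕ.≤-Reasoning

linear-bound : ∀ {c n W} → 2 * c + 2 * n ≡ W * n + 2 → 2 * c ≤ (W ∸ 2) * n + 2
linear-bound {c} {n} {W} invariant = ℕ.+-cancelʳ-≤ (2 * n) _ _ (begin
  2 * c + 2 * n              ≡⟨ invariant ⟩
  W * n + 2                  ≤⟨ ℕ.+-monoˡ-≤ 2 (ℕ.*-monoˡ-≤ n (ℕ.m≤n+m∸n W 2)) ⟩
  (2 + (W ∸ 2)) * n + 2      ≡⟨ rearrange (W ∸ 2) n ⟩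
  (W ∸ 2) * n + 2 + 2 * n    ∎)
  where
  open ℕ.≤-Reasoning
  rearrange : ∀ w n → (2 + w) * n + 2 ≡ w * n + 2 + 2 * n
  rearrange = solve-∀

nlogn-bound : ∀ {c n W M D} → 2 * c + 2 * n ≡ W * n + 2 → W ≤ 4 * M * D → 1 ≤ n → 2 ^ D ≤ n →
              2 ^ c ≤ n ^ (2 * M * n)
nlogn-bound {c} {n} {W} {M} {D} invariant W≤4MD 1≤n 2^D≤n = begin
  2 ^ c                 ≤⟨ ℕ.^-monoʳ-≤ 2 c≤DMn ⟩
  2 ^ (D * (2 * M * n)) ≡⟨ ℕ.^-*-assoc 2 D (2 * M * n) ⟨
  (2 ^ D) ^ (2 * M * n) ≤⟨ ℕ.^-monoˡ-≤ (2 * M * n) 2^D≤n ⟩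
  n ^ (2 * M * n)       ∎
  where
  open ℕ.≤-Reasoning
  double : ∀ M D n → 4 * M * D * n ≡ 2 * (D * (2 * M * n))
  double = solve-∀
  c≤DMn : c ≤ D * (2 * M * n)
  c≤DMn = ℕ.*-cancelˡ-≤ 2 (ℕ.+-cancelʳ-≤ (2 * n) _ _ (begin
    2 * c + 2 * n                  ≡⟨ invariant ⟩
    W * n + 2                      ≤⟨ ℕ.+-mono-≤ (ℕ.*-monoˡ-≤ n W≤4MD) (ℕ.*-monoʳ-≤ 2 1≤n) ⟩
    4 * M * D * n + 2 * n          ≡⟨ ≡.cong (_+ 2 * n) (double M D n) ⟩
    2 * (D * (2 * M * n)) + 2 * n  ∎))

corollary1 : ∀ {c ℓ a ℓa} (K : CommutativeRing c ℓ) → IsField K →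
    (A : Ring a ℓa) → FinDimAlgebra K A →
    (n : ℕ) → 2 ≤ n →
    (d₁ t : ℕ) (q : Fin t → ℕ) (e : Fin t → ℕ) →
    (∀ i → Prime (q i)) → (∀ i → 2 < q i) →
    (∀ i j → i Data.Fin.< j → q i < q j) →
    n ≡ 2 ^ d₁ * prodℕ (λ i → q i ^ e i) →
    (ω : Ring.Carrier A) → IsPrincipalRoot A n ω →
    Σ (SLP n n) λ P → ComputesDFT A n ω P ×
      (2 * cost P ≤ (3 * d₁ + 4 * sumℕ (λ i → e i * (q i ∸ 1)) ∸ 2) * n + 2) ×
      (2 ^ cost P ≤ n ^ (2 * maxℕ 2 q * n))
corollary1 K _ A _ n 2≤n d₁ t q e _ 2<q _ n≡ ω root =
  P , computes , linear-bound {cost P} {n} {W} invariant ,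
  nlogn-bound {cost P} {n} {W} {maxℕ 2 q} {d₁ + sumℕ e} invariant (weight-bound d₁ q e)
              (ℕ.≤-trans (s≤s z≤n) 2≤n) (ℕ.≤-trans (2^length≤order d₁ q e 2≤q) (ℕ.≤-reflexive (≡.sym n≡)))
  where
  open ≡.≡-Reasoning
  2≤q : ∀ i → 2 ≤ q i
  2≤q i = ℕ.<⇒≤ (2<q i)
  L : List Radix
  L = plan d₁ q e
  order≡n : order L ≡ n
  order≡n = ≡.trans (order-plan d₁ q e (λ i → ℕ.≤-trans (s≤s z≤n) (2≤q i))) (≡.sym n≡)
  program : Σ (SLP n n) λ P → ComputesDFT A n ω P × cost P ≡ fftCost L
  program = fft-program A ω L order≡n root
  P : SLP n n
  P = proj₁ program
  computes : ComputesDFT A n ω P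
  computes = proj₁ (proj₂ program)
  W : ℕ
  W = 3 * d₁ + 4 * sumℕ (λ i → e i * (q i ∸ 1))
  invariant : 2 * cost P + 2 * n ≡ W * n + 2
  invariant = begin
    2 * cost P + 2 * n          ≡⟨ ≡.cong₂ (λ c k → 2 * c + 2 * k) (proj₂ (proj₂ program)) (≡.sym order≡n) ⟩
    2 * fftCost L + 2 * order L ≡⟨ fftCost-invariant L ⟩
    weights L * order L + 2     ≡⟨ ≡.cong₂ (λ w k → w * k + 2) (weights-plan d₁ q e) order≡n ⟩
    W * n + 2                   ∎
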